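{- Let $S$ be a subalgebra of $\mathbf{Z}_{2n+1}^{2}$. (i) If $S\subseteq(\delta^-,\delta^-)^{ -1}(\le)$ then there exists a partial endomorphism $e$ of $\mathbf{Z}_{2n+1}$ such that $S=\mathrm{graph}\,e$. (ii) If $S\subseteq(\delta^+,\delta^+)^{ -1}(\le)$ then there exists a partial endomorphism $e$ of $\mathbf{Z}_{2n+1}$ such that $S^{\smile}=\mathrm{graph}\,e$. (iii) If $S\subseteq(\delta^-,\delta^+)^{ -1}(\le)$ then there exists a partial endomorphism $e$ of $\mathbf{Z}_{2n+1}$ such that $0\notin\mathrm{img}\,e\cup\mathrm{dom}\,e$ and $S=\mathrm{graph}\,e$. (iv) If $S\subseteq(\delta^+,\delta^-)^{ -1}(\le)$ then $S$ or $S^{\smile}$ is the graph of a partial endomorphism.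
   Context: $\mathbf{Z}_{2n+1}$ is the Sugihara algebra on $\{ -n,\ldots,n\}$ (lattice order of integers, $\neg a=-a$, $a\to b=(-a)\vee b$ if $a\le b$, $(-a)\wedge b$ otherwise). $\delta^+(a)=1\iff a\ge1$ and $\delta^-(a)=1\iff a\ge0$ define lattice homomorphisms into $\{0,1\}$. For such maps $\omega,\omega'$, $(\omega,\omega')^{ -1}(\le)=\{(a,b)\in\mathbf{Z}_{2n+1}^2\mid\omega(a)\le\omega'(b)\}$. $S^{\smile}=\{(b,a)\mid(a,b)\in S\}$ denotes the converse relation. A partial endomorphism is a homomorphism from a subalgebra of $\mathbf{Z}_{2n+1}$ into $\mathbf{Z}_{2n+1}$. -}

module Defs where

open import Data.Integer using (ℤ; +_; -_; _≤_; _⊓_; _⊔_; _≤ᵇ_)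
open import Data.Nat using (ℕ)
import Data.Nat as ℕ
open import Data.Bool using (Bool; true; false; if_then_else_; T)
open import Data.Product using (_×_; Σ; ∃)
open import Relation.Binary.PropositionalEquality using (_≡_; _≢_)
open import Relation.Nullary using (¬_)
open import Function.Bundles using (_⇔_)

-- The Sugihara algebra Z_{2n+1}: the integers in [-n, n], with
-- meet = min, join = max, negation = -, and the implication below.
-- Operations are given on all of ℤ; they restrict to [-n, n].

InZ : ℕ → ℤ → Set
InZ n a = (- (+ n) ≤ a) × (a ≤ + n)

_⇒_ : ℤ → ℤ → ℤ
a ⇒ b = if a ≤ᵇ b then (- a) ⊔ b else (- a) ⊓ b

δ⁺ : ℤ → ℕ
δ⁺ a = if (+ 1) ≤ᵇ a then 1 else 0

δ⁻ : ℤ → ℕ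
δ⁻ a = if (+ 0) ≤ᵇ a then 1 else 0

Preim≤ : (ℤ → ℕ) → (ℤ → ℕ) → ℤ → ℤ → Set
Preim≤ ω ω' a b = ω a ℕ.≤ ω' b

Subset₁ : Set
Subset₁ = ℤ → Bool

Subset₂ : Set
Subset₂ = ℤ → ℤ → Bool

record IsSubalg (n : ℕ) (D : Subset₁) : Set where
  field
    inRange : ∀ a → T (D a) → InZ n a
    ∧-closed : ∀ a b → T (D a) → T (D b) → T (D (a ⊓ b))
    ∨-closed : ∀ a b → T (D a) → T (D b) → T (D (a ⊔ b))
    ¬-closed : ∀ a → T (D a) → T (D (- a))
    ⇒-closed : ∀ a b → T (D a) → T (D b) → T (D (a ⇒ b))

record IsSubalg² (n : ℕ) (S : Subset₂) : Set where
  field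
    inRange : ∀ a b → T (S a b) → InZ n a × InZ n b
    ∧-closed : ∀ a b c d → T (S a b) → T (S c d) → T (S (a ⊓ c) (b ⊓ d))
    ∨-closed : ∀ a b c d → T (S a b) → T (S c d) → T (S (a ⊔ c) (b ⊔ d))
    ¬-closed : ∀ a b → T (S a b) → T (S (- a) (- b))
    ⇒-closed : ∀ a b c d → T (S a b) → T (S c d) → T (S (a ⇒ c) (b ⇒ d))

-- A partial endomorphism: a homomorphism from the subalgebra D (its domain)
-- into Z_{2n+1}; e is only relevant on D.
record IsPartialEndo (n : ℕ) (D : Subset₁) (e : ℤ → ℤ) : Set where
  field
    domSubalg : IsSubalg n D
    into : ∀ a → T (D a) → InZ n (e a)
    pres-∧ : ∀ a b → T (D a) → T (D b) → e (a ⊓ b) ≡ e a ⊓ e b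
    pres-∨ : ∀ a b → T (D a) → T (D b) → e (a ⊔ b) ≡ e a ⊔ e b
    pres-¬ : ∀ a → T (D a) → e (- a) ≡ - e a
    pres-⇒ : ∀ a b → T (D a) → T (D b) → e (a ⇒ b) ≡ e a ⇒ e b

_⊆_ : Subset₂ → (ℤ → ℤ → Set) → Set
S ⊆ R = ∀ a b → T (S a b) → R a b

_˘ : Subset₂ → Subset₂
(S ˘) a b = S b a

IsGraph : Subset₂ → Subset₁ → (ℤ → ℤ) → Set
IsGraph S D e = ∀ a b → T (S a b) ⇔ (T (D a) × e a ≡ b)

IsGraphOfPE : ℕ → Subset₂ → Set
IsGraphOfPE n S = Σ Subset₁ λ D → Σ (ℤ → ℤ) λ e → IsPartialEndo n D e × IsGraph S D e

ZeroAvoiding : Subset₁ → (ℤ → ℤ) → Set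
ZeroAvoiding D e = ¬ T (D (+ 0)) × (∀ a → T (D a) → e a ≢ + 0)

module Submission where

-- A subalgebra S of Z_{2n+1}² that is functional (each a has at
-- most one partner) is the graph of a partial endomorphism: its domain and
-- values are found by a bounded search over [-n, n], and the homomorphism
-- laws are just the closure properties of S read through the graph.
-- Functionality is obtained from one computation with the implication:
-- if (a, b), (a, c) ∈ S with b < c then (a → a, c → b) ∈ S, where a → a ≥ 0
-- and c → b < 0.  So a subalgebra meeting no pair of the "crossing"
-- quadrant x ≥ 0 > y is functional; dually (using negation) S˘ is
-- functional when S meets no pair with x > 0 ≥ y.  Finally, the hypothesis
-- S ⊆ (ω, ω')⁻¹(≤) forbids exactly the pairs sent to (1, 0), i.e. a quadrant
-- determined by the two δ's; each part of the theorem checks that the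
-- relevant crossing quadrant is forbidden, with a short extra argument
-- for the zero-avoidance in (iii) and a case split on S ∩ ({0} × Z) in (iv).

open import Defs
open import Data.Nat using (ℕ; zero; suc)
import Data.Nat as ℕ
import Data.Nat.Properties as ℕ
open import Data.Integer using (ℤ; +_; -[1+_]; -_; _≤_; _<_; _⊓_; _⊔_; -≤-; +≤+; +<+; _<?_)
open import Data.Integer.Properties
  using (≤ᵇ⇒≤; ≤⇒≤ᵇ; ≤-refl; ≤-trans; ≤-antisym; ≤-total; <⇒≤; <⇒≱; ≮⇒≥; <-cmp;
         <-≤-trans; ≤-<-trans; neg-mono-<; neg-mono-≤; i⊓j≤i; i⊓j≤j; i≤i⊔j; i≤j⊔i; i<j⇒suc[i]≤j)
open import Data.Bool using (true; false; if_then_else_; T)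
open import Data.Unit using (tt)
open import Data.Empty using (⊥; ⊥-elim)
open import Data.List using (List; []; _∷_)
open import Data.List.Membership.Propositional using (_∈_; lose)
open import Data.List.Relation.Unary.Any using (here; there; any?; satisfied)
open import Data.Product using (_×_; Σ; _,_; proj₁; proj₂)
open import Data.Sum using (_⊎_; inj₁; inj₂)
open import Function using (_∘_)
open import Function.Bundles using (mk⇔; Equivalence)
open import Relation.Binary.PropositionalEquality using (_≡_; refl; subst; subst₂)
open import Relation.Binary.Definitions using (tri<; tri≈; tri>)
open import Relation.Nullary using (¬_; yes; no)
open import Relation.Nullary.Decidable using (T?; _×-dec_)
open import Relation.Unary using (Decidable)

-- The carrier [-n, n] of Z_{2n+1} as a list, and the fact that it is
-- complete; this makes existence of partners decidable.
range : ℕ → List ℤ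
range zero = + 0 ∷ []
range (suc n) = + suc n ∷ -[1+ n ] ∷ range n

nonneg∈range : ∀ n k → k ℕ.≤ n → + k ∈ range n
nonneg∈range zero zero ℕ.z≤n = here refl
nonneg∈range (suc n) k k≤ with ℕ.m≤n⇒m<n∨m≡n k≤
... | inj₁ (ℕ.s≤s k≤n) = there (there (nonneg∈range n k k≤n))
... | inj₂ refl = here refl

neg∈range : ∀ n k → suc k ℕ.≤ n → -[1+ k ] ∈ range n
neg∈range (suc n) k (ℕ.s≤s k≤) with ℕ.m≤n⇒m<n∨m≡n k≤
... | inj₁ k<n = there (there (neg∈range n k k<n))
... | inj₂ refl = there (here refl)

∈-range : ∀ n z → InZ n z → z ∈ range n
∈-range n (+ k) (_ , +≤+ k≤n) = nonneg∈range n k k≤n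
∈-range (suc n) -[1+ k ] (-≤- k≤n , _) = neg∈range (suc n) k (ℕ.s≤s k≤n)

search : ∀ n {P : ℤ → Set} → Decidable P → Σ ℤ P ⊎ (∀ y → InZ n y → ¬ P y)
search n P? with any? P? (range n)
... | yes found = inj₁ (satisfied found)
... | no none = inj₂ (λ y y∈Z py → none (lose (∈-range n y y∈Z) py))

Functional : Subset₂ → Set
Functional S = ∀ a b c → T (S a b) → T (S a c) → b ≡ c

functional⇒graphOfPE : ∀ {n S} → IsSubalg² n S → Functional S → IsGraphOfPE n S
functional⇒graphOfPE {n} {S} SA functional = D , e , endo , graph
  where
  open IsSubalg² SA

  partner : ∀ a → Σ ℤ (T ∘ S a) ⊎ (∀ b → InZ n b → ¬ T (S a b))
  partner a = search n (T? ∘ S a)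

  D : Subset₁
  D a with partner a
  ... | inj₁ _ = true
  ... | inj₂ _ = false

  e : ℤ → ℤ
  e a with partner a
  ... | inj₁ (b , _) = b
  ... | inj₂ _ = + 0

  onGraph : ∀ a → T (D a) → T (S a (e a))
  onGraph a a∈D with partner a
  ... | inj₁ (_ , s) = s

  fromGraph : ∀ a b → T (S a b) → T (D a) × e a ≡ b
  fromGraph a b s with partner a
  ... | inj₁ (c , s′) = tt , functional a c b s′ s
  ... | inj₂ none = ⊥-elim (none b (proj₂ (inRange a b s)) s)

  graph : IsGraph S D e
  graph a b = mk⇔ (fromGraph a b) (λ { (a∈D , refl) → onGraph a a∈D })

  preserves₂ : ∀ {f : ℤ → ℤ → ℤ} →
    (∀ a b c d → T (S a b) → T (S c d) → T (S (f a c) (f b d))) →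
    ∀ a c → T (D a) → T (D c) → T (D (f a c)) × e (f a c) ≡ f (e a) (e c)
  preserves₂ closed a c a∈D c∈D =
    fromGraph _ _ (closed _ _ _ _ (onGraph a a∈D) (onGraph c c∈D))

  preserves-¬ : ∀ a → T (D a) → T (D (- a)) × e (- a) ≡ - e a
  preserves-¬ a a∈D = fromGraph _ _ (¬-closed _ _ (onGraph a a∈D))

  endo : IsPartialEndo n D e
  endo = record
    { domSubalg = record
      { inRange = λ a a∈D → proj₁ (inRange a (e a) (onGraph a a∈D))
      ; ∧-closed = λ a c p q → proj₁ (preserves₂ ∧-closed a c p q)
      ; ∨-closed = λ a c p q → proj₁ (preserves₂ ∨-closed a c p q)
      ; ¬-closed = λ a p → proj₁ (preserves-¬ a p)
      ; ⇒-closed = λ a c p q → proj₁ (preserves₂ ⇒-closed a c p q)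
      }
    ; into = λ a a∈D → proj₂ (inRange a (e a) (onGraph a a∈D))
    ; pres-∧ = λ a c p q → proj₂ (preserves₂ ∧-closed a c p q)
    ; pres-∨ = λ a c p q → proj₂ (preserves₂ ∨-closed a c p q)
    ; pres-¬ = λ a p → proj₂ (preserves-¬ a p)
    ; pres-⇒ = λ a c p q → proj₂ (preserves₂ ⇒-closed a c p q)
    }

converse : ∀ {n S} → IsSubalg² n S → IsSubalg² n (S ˘)
converse SA = record
  { inRange = λ a b s → proj₂ (inRange b a s) , proj₁ (inRange b a s)
  ; ∧-closed = λ a b c d → ∧-closed b a d c
  ; ∨-closed = λ a b c d → ∨-closed b a d c
  ; ¬-closed = λ a b → ¬-closed b a
  ; ⇒-closed = λ a b c d → ⇒-closed b a d c
  }
  where open IsSubalg² SA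

if-true : ∀ {A : Set} {b} (x y : A) → T b → (if b then x else y) ≡ x
if-true {b = true} x y _ = refl

if-false : ∀ {A : Set} {b} (x y : A) → ¬ T b → (if b then x else y) ≡ y
if-false {b = true} x y ¬t = ⊥-elim (¬t tt)
if-false {b = false} x y _ = refl

⇒-≤ : ∀ {a b} → a ≤ b → a ⇒ b ≡ (- a) ⊔ b
⇒-≤ {a} {b} a≤b = if-true ((- a) ⊔ b) ((- a) ⊓ b) (≤⇒≤ᵇ a≤b)

⇒-> : ∀ {a b} → b < a → a ⇒ b ≡ (- a) ⊓ b
⇒-> {a} {b} b<a = if-false ((- a) ⊔ b) ((- a) ⊓ b) (<⇒≱ b<a ∘ ≤ᵇ⇒≤)

⇒-self-nonneg : ∀ a → + 0 ≤ a ⇒ a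
⇒-self-nonneg a rewrite ⇒-≤ (≤-refl {a}) with ≤-total (+ 0) a
... | inj₁ 0≤a = ≤-trans 0≤a (i≤j⊔i (- a) a)
... | inj₂ a≤0 = ≤-trans (neg-mono-≤ a≤0) (i≤i⊔j (- a) a)

⇒-desc-neg : ∀ {b c} → b < c → c ⇒ b < + 0
⇒-desc-neg {b} {c} b<c rewrite ⇒-> b<c with b <? + 0
... | yes b<0 = ≤-<-trans (i⊓j≤j (- c) b) b<0
... | no b≮0 = ≤-<-trans (i⊓j≤i (- c) b) (neg-mono-< (≤-<-trans (≮⇒≥ b≮0) b<c))

⇒-upper : ∀ {a b} → a ≤ b → b ≤ a ⇒ b
⇒-upper {a} {b} a≤b rewrite ⇒-≤ a≤b = i≤j⊔i (- a) b

δ⁻-nonneg : ∀ {x} → + 0 ≤ x → δ⁻ x ≡ 1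
δ⁻-nonneg 0≤x = if-true 1 0 (≤⇒≤ᵇ 0≤x)

δ⁻-neg : ∀ {x} → x < + 0 → δ⁻ x ≡ 0
δ⁻-neg x<0 = if-false 1 0 (<⇒≱ x<0 ∘ ≤ᵇ⇒≤)

δ⁺-pos : ∀ {x} → + 0 < x → δ⁺ x ≡ 1
δ⁺-pos 0<x = if-true 1 0 (≤⇒≤ᵇ (i<j⇒suc[i]≤j 0<x))

δ⁺-nonpos : ∀ {x} → x ≤ + 0 → δ⁺ x ≡ 0
δ⁺-nonpos x≤0 = if-false 1 0 (λ t → <⇒≱ (+<+ (ℕ.s≤s ℕ.z≤n)) (≤-trans (≤ᵇ⇒≤ t) x≤0))

forbidden : ∀ {S ω ω'} → S ⊆ Preim≤ ω ω' → ∀ {x y} → T (S x y) → ω x ≡ 1 → ω' y ≡ 0 → ⊥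
forbidden h {x} {y} s ωx≡1 ω'y≡0 = ℕ.<-irrefl refl (subst₂ ℕ._≤_ ωx≡1 ω'y≡0 (h x y s))

Meets : Subset₂ → (ℤ → Set) → (ℤ → Set) → Set
Meets S P Q = Σ ℤ λ x → Σ ℤ λ y → T (S x y) × P x × Q y

split⇒crossing : ∀ {n S a b c} → IsSubalg² n S → T (S a b) → T (S a c) → b < c →
  Meets S (+ 0 ≤_) (_< + 0)
split⇒crossing {a = a} {b} {c} SA s t b<c =
  a ⇒ a , c ⇒ b , IsSubalg².⇒-closed SA a c a b t s , ⇒-self-nonneg a , ⇒-desc-neg b<c

functional-if-no-crossing : ∀ {n S} → IsSubalg² n S → ¬ Meets S (+ 0 ≤_) (_< + 0) → Functional S
functional-if-no-crossing SA none a b c s t with <-cmp b c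
... | tri< b<c _ _ = ⊥-elim (none (split⇒crossing SA s t b<c))
... | tri≈ _ b≡c _ = b≡c
... | tri> _ _ c<b = ⊥-elim (none (split⇒crossing SA t s c<b))

-- Dually, the converse is functional when S misses the quadrant x > 0 ≥ y:
-- a crossing pair (y, x) of S˘ gives, negated, the pair (-x, -y) there.
converse-functional-if : ∀ {n S} → IsSubalg² n S → ¬ Meets S (+ 0 <_) (_≤ + 0) → Functional (S ˘)
converse-functional-if SA none = functional-if-no-crossing (converse SA)
  λ { (x , y , s , 0≤x , y<0) →
        none (- y , - x , IsSubalg².¬-closed SA y x s , neg-mono-< y<0 , neg-mono-≤ 0≤x) }

-- Part (i): δ⁻ × δ⁻ forbids the crossing quadrant itself.
part-i : ∀ {n S} → IsSubalg² n S → S ⊆ Preim≤ δ⁻ δ⁻ → IsGraphOfPE n S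
part-i SA h = functional⇒graphOfPE SA (functional-if-no-crossing SA
  λ { (_ , _ , s , 0≤x , y<0) → forbidden h s (δ⁻-nonneg 0≤x) (δ⁻-neg y<0) })

-- Part (ii): δ⁺ × δ⁺ forbids the quadrant x > 0 ≥ y.
part-ii : ∀ {n S} → IsSubalg² n S → S ⊆ Preim≤ δ⁺ δ⁺ → IsGraphOfPE n (S ˘)
part-ii SA h = functional⇒graphOfPE (converse SA) (converse-functional-if SA
  λ { (_ , _ , s , 0<x , y≤0) → forbidden h s (δ⁺-pos 0<x) (δ⁺-nonpos y≤0) })

-- In a subalgebra missing the quadrant x ≥ 0 ≥ y, no pair has 0 as a
-- coordinate: otherwise it or its negation would lie in that quadrant.
zero-free-left : ∀ {n S} → IsSubalg² n S → ¬ Meets S (+ 0 ≤_) (_≤ + 0) → ∀ y → ¬ T (S (+ 0) y)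
zero-free-left SA none y s with ≤-total y (+ 0)
... | inj₁ y≤0 = none (+ 0 , y , s , ≤-refl , y≤0)
... | inj₂ 0≤y = none (+ 0 , - y , IsSubalg².¬-closed SA _ _ s , ≤-refl , neg-mono-≤ 0≤y)

zero-free-right : ∀ {n S} → IsSubalg² n S → ¬ Meets S (+ 0 ≤_) (_≤ + 0) → ∀ x → ¬ T (S x (+ 0))
zero-free-right SA none x s with ≤-total (+ 0) x
... | inj₁ 0≤x = none (x , + 0 , s , 0≤x , ≤-refl)
... | inj₂ x≤0 = none (- x , + 0 , IsSubalg².¬-closed SA _ _ s , neg-mono-≤ x≤0 , ≤-refl)

zeroAvoidingGraph : ∀ {n S} → IsGraphOfPE n S →
  (∀ y → ¬ T (S (+ 0) y)) → (∀ x → ¬ T (S x (+ 0))) →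
  Σ Subset₁ λ D → Σ (ℤ → ℤ) λ e → IsPartialEndo n D e × ZeroAvoiding D e × IsGraph S D e
zeroAvoidingGraph {S = S} (D , e , endo , graph) free-left free-right =
  D , e , endo , ((λ 0∈D → free-left (e (+ 0)) (onGraph 0∈D))
                 , (λ a a∈D ea≡0 → free-right a (subst (T ∘ S a) ea≡0 (onGraph a∈D))))
    , graph
  where
  onGraph : ∀ {a} → T (D a) → T (S a (e a))
  onGraph {a} a∈D = Equivalence.from (graph a (e a)) (a∈D , refl)

-- Part (iii): δ⁻ × δ⁺ forbids the quadrant x ≥ 0 ≥ y, which contains the
-- crossing quadrant and also rules out zero coordinates.
part-iii : ∀ {n S} → IsSubalg² n S → S ⊆ Preim≤ δ⁻ δ⁺ → Σ Subset₁ λ D → Σ (ℤ → ℤ) λ e →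
  IsPartialEndo n D e × ZeroAvoiding D e × IsGraph S D e
part-iii {S = S} SA h =
  zeroAvoidingGraph
    (functional⇒graphOfPE SA (functional-if-no-crossing SA
      λ { (x , y , s , 0≤x , y<0) → none (x , y , s , 0≤x , <⇒≤ y<0) }))
    (zero-free-left SA none) (zero-free-right SA none)
  where
  none : ¬ Meets S (+ 0 ≤_) (_≤ + 0)
  none (_ , _ , s , 0≤x , y≤0) = forbidden h s (δ⁻-nonneg 0≤x) (δ⁺-nonpos y≤0)

-- Part (iv), first case: if 0 has no positive partner, S is functional.
-- δ⁺ × δ⁻ forbids x > 0 > y, so a crossing pair (x, y) has x = 0, and then
-- (0, -y) ∈ S with -y > 0.
part-iv-functional : ∀ {n S} → IsSubalg² n S → S ⊆ Preim≤ δ⁺ δ⁻ →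
  (∀ y → T (S (+ 0) y) → ¬ (+ 0 < y)) → Functional S
part-iv-functional SA h noPositive = functional-if-no-crossing SA crossing-impossible
  where
  crossing-impossible : ¬ Meets _ (+ 0 ≤_) (_< + 0)
  crossing-impossible (x , y , s , 0≤x , y<0) with + 0 <? x
  ... | yes 0<x = forbidden h s (δ⁺-pos 0<x) (δ⁻-neg y<0)
  ... | no 0≮x with ≤-antisym (≮⇒≥ 0≮x) 0≤x
  ...   | refl = noPositive (- y) (IsSubalg².¬-closed SA _ _ s) (neg-mono-< y<0)

-- A pair (x, y) with x > 0 ≥ y must have y = 0 (δ⁺ × δ⁻
-- forbids y < 0), and then (0 → x, y₀ → 0) ∈ S is a forbidden pair with
-- 0 → x ≥ x > 0 and y₀ → 0 < 0.
part-iv-converse : ∀ {n S y₀} → IsSubalg² n S → S ⊆ Preim≤ δ⁺ δ⁻ →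
  T (S (+ 0) y₀) → + 0 < y₀ → Functional (S ˘)
part-iv-converse {y₀ = y₀} SA h s₀ 0<y₀ = converse-functional-if SA quadrant-impossible
  where
  quadrant-impossible : ¬ Meets _ (+ 0 <_) (_≤ + 0)
  quadrant-impossible (x , y , s , 0<x , y≤0) with y <? + 0
  ... | yes y<0 = forbidden h s (δ⁺-pos 0<x) (δ⁻-neg y<0)
  ... | no y≮0 with ≤-antisym y≤0 (≮⇒≥ y≮0)
  ...   | refl = forbidden h (IsSubalg².⇒-closed SA _ _ _ _ s₀ s)
                   (δ⁺-pos (<-≤-trans 0<x (⇒-upper (<⇒≤ 0<x)))) (δ⁻-neg (⇒-desc-neg 0<y₀))

part-iv : ∀ {n S} → IsSubalg² n S → S ⊆ Preim≤ δ⁺ δ⁻ → IsGraphOfPE n S ⊎ IsGraphOfPE n (S ˘)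
part-iv {n} {S} SA h with search n (λ y → T? (S (+ 0) y) ×-dec (+ 0 <? y))
... | inj₁ (y₀ , s₀ , 0<y₀) =
  inj₂ (functional⇒graphOfPE (converse SA) (part-iv-converse SA h s₀ 0<y₀))
... | inj₂ none =
  inj₁ (functional⇒graphOfPE SA (part-iv-functional SA h
    λ y s 0<y → none y (proj₂ (IsSubalg².inRange SA _ _ s)) (s , 0<y)))

proposition4p2 : (n : ℕ) → (S : Subset₂) → IsSubalg² n S →
      ((S ⊆ Preim≤ δ⁻ δ⁻) → IsGraphOfPE n S)
    × ((S ⊆ Preim≤ δ⁺ δ⁺) → IsGraphOfPE n (S ˘))
    × ((S ⊆ Preim≤ δ⁻ δ⁺) → Σ Subset₁ λ D → Σ (ℤ → ℤ) λ e →
          IsPartialEndo n D e × ZeroAvoiding D e × IsGraph S D e)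
    × ((S ⊆ Preim≤ δ⁺ δ⁻) → IsGraphOfPE n S ⊎ IsGraphOfPE n (S ˘))
proposition4p2 n S SA = part-i SA , part-ii SA , part-iii SA , part-iv SA
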